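{- Let $p$ be a prime and $k\ge 2$ an integer. For any integer $c\ge0$, \[F_{p^{2k}+c}\equiv F_{p^{2(k-1)}+c}\pmod{p^k}.\]
   Context: $(F_n)$ denotes the Fibonacci sequence ($F_0=0$, $F_1=F_2=1$, $F_{n+2}=F_{n+1}+F_n$). -}

module Defs where

open import Data.Nat using (ℕ; zero; suc; _+_)

F : ℕ → ℕ
F zero = 0
F (suc zero) = 1
F (suc (suc n)) = F (suc n) + F n

-- In ℤ[φ] = ℤ[T]/(T² − T − 1) one has φ^(n+1) = F n + F (n+1) φ, so congruences between powers of φ
-- modulo an integer give congruences between Fibonacci numbers.  Modulo a prime p the Frobenius
-- x ↦ x^p is additive and fixes integers; hence y = φ^p = F (p−1) + F p φ satisfies y^p ≡ g y for
-- the affine map g w = F (p−1) + F p w, and y is again a root of T² − T − 1.  The residues of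
-- F (p−1) and F p then give g (g y) ≡ y, i.e. φ^(p³) ≡ φ^p (mod p); the cube is needed
-- because φ^(p²) ≡ φ fails for p = 5, where φ^5 ≡ 3.  Raising to p-th powers lifts a congruence
-- modulo p^j to one modulo p^(j+1), so φ^(p^(2k)) ≡ φ^(p^(2k−2)) modulo p^(2k−2), hence modulo p^k;
-- multiplying by φ^(c+1) and comparing constant coefficients yields the theorem.
module Submission where

open import Level using (0ℓ; _⊔_)
open import Algebra.Bundles using (CommutativeSemiring)
open import Data.Empty using (⊥-elim)
open import Data.Fin.Base using (Fin; zero; suc; toℕ; fromℕ; inject₁)
open import Data.Fin.Properties using (toℕ-fromℕ; toℕ-inject₁; toℕ<n)
open import Data.List.Base using ([]; _∷_)
open import Data.Maybe.Base using (nothing)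
open import Data.Nat.Base using (ℕ; zero; suc; _<_; s<s)
import Data.Nat.Base as ℕ
import Data.Nat.Properties as ℕ
import Data.Nat.Divisibility as ℕ
open import Data.Nat.Combinatorics using (_C_; nC1≡n; nCn≡1; nCk+nC[k+1]≡[n+1]C[k+1])
open import Data.Nat.Primality using (Prime; euclidsLemma)
open import Data.Product.Base using (∃₂; _,_; proj₁; proj₂)
open import Data.Sum.Base using (_⊎_; inj₁; inj₂; [_,_])
open import Function.Base using (_∘_; id)
open import Relation.Binary.Bundles using (Setoid)
open import Relation.Binary.PropositionalEquality as ≡ using (_≡_)
import Relation.Binary.Reasoning.Setoid
open import Defs using (F)

module BinomialCoefficients where
  open import Data.Nat.Base using (_+_; _*_)
  open import Data.Nat.Divisibility using (_∣_; divides; ∣⇒≤)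
  open import Data.Nat.Tactic.RingSolver using (solve-∀)

  [1+k]*[1+n]C[1+k]≡[1+n]*nCk : ∀ n k → suc k * (suc n C suc k) ≡ suc n * (n C k)
  [1+k]*[1+n]C[1+k]≡[1+n]*nCk zero    zero    = ≡.refl
  [1+k]*[1+n]C[1+k]≡[1+n]*nCk zero    (suc k) = ℕ.*-zeroʳ (2 + k)
  [1+k]*[1+n]C[1+k]≡[1+n]*nCk (suc n) zero    =
    ≡.trans (ℕ.*-identityˡ _) (≡.trans (nC1≡n (2 + n)) (≡.sym (ℕ.*-identityʳ (2 + n))))
  [1+k]*[1+n]C[1+k]≡[1+n]*nCk (suc n) (suc k) = begin
    (2 + k) * ((2 + n) C (2 + k))               ≡⟨ ≡.cong ((2 + k) *_) (nCk+nC[k+1]≡[n+1]C[k+1] (suc n) (suc k)) ⟨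
    (2 + k) * (A + B)                           ≡⟨ expand k A B ⟩
    A + (suc k * A + (2 + k) * B)               ≡⟨ ≡.cong₂ (λ u v → A + (u + v)) ([1+k]*[1+n]C[1+k]≡[1+n]*nCk n k)
                                                                              ([1+k]*[1+n]C[1+k]≡[1+n]*nCk n (suc k)) ⟩
    A + (suc n * (n C k) + suc n * (n C suc k)) ≡⟨ ≡.cong (A +_) (ℕ.*-distribˡ-+ (suc n) (n C k) (n C suc k)) ⟨
    A + suc n * (n C k + n C suc k)             ≡⟨ ≡.cong (λ u → A + suc n * u) (nCk+nC[k+1]≡[n+1]C[k+1] n k) ⟩
    A + suc n * A                               ∎
    where
    open ≡.≡-Reasoning
    A = suc n C suc k
    B = suc n C (2 + k)
    expand : ∀ k A B → (2 + k) * (A + B) ≡ A + (suc k * A + (2 + k) * B)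
    expand = solve-∀

  prime∣pC[1+k] : ∀ {p k} → Prime p → suc k < p → p ∣ p C suc k
  prime∣pC[1+k] {suc n} {k} pp 1+k<p
    with euclidsLemma (suc k) (suc n C suc k) pp
           (divides (n C k) (≡.trans ([1+k]*[1+n]C[1+k]≡[1+n]*nCk n k) (ℕ.*-comm (suc n) (n C k))))
  ... | inj₁ p∣1+k      = ⊥-elim (ℕ.<⇒≱ 1+k<p (∣⇒≤ p∣1+k))
  ... | inj₂ p∣pC[1+k] = p∣pC[1+k]

open BinomialCoefficients using (prime∣pC[1+k])

module CongruenceModulo {c ℓ} (R : CommutativeSemiring c ℓ) where

  open CommutativeSemiring R hiding (zero)
  open import Data.Nat.Divisibility using (_∣_; divides)
  open import Algebra.Properties.Semiring.Mult semiring using (_×_; ×-assoc-*; ×-comm-*; ×-congʳ; ×1-homo-*)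
  open import Algebra.Properties.Semiring.Exp semiring using (_^_; ^-congˡ; ^-assocʳ)
  open import Algebra.Properties.CommutativeSemiring.Exp R using (^-distrib-*)
  open import Algebra.Properties.CommutativeSemiring.Binomial R using (theorem; binomialTerm)
  open import Algebra.Properties.Monoid.Sum +-monoid using (sum; sum-init-last)
  open import Algebra.Solver.Ring.NaturalCoefficients R (λ _ _ → nothing)
    using (solve; _:=_; _:+_; _:*_; con)

  module ≈-Reasoning = Relation.Binary.Reasoning.Setoid setoid

  -- Congruence modulo the ideal m R, phrased without subtraction so that it makes sense in a semiring.
  infix 4 _≡_mod_
  _≡_mod_ : Carrier → Carrier → Carrier → Set (c ⊔ ℓ)
  x ≡ y mod m = ∃₂ λ d e → x + m * d ≈ y + m * e

  ≡-reflexive : ∀ {m x y} → x ≈ y → x ≡ y mod m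
  ≡-reflexive x≈y = 0# , 0# , +-congʳ x≈y

  ≡-refl : ∀ {m x} → x ≡ x mod m
  ≡-refl = ≡-reflexive refl

  ≡-sym : ∀ {m x y} → x ≡ y mod m → y ≡ x mod m
  ≡-sym (d , e , x+md≈y+me) = e , d , sym x+md≈y+me

  ≡-trans : ∀ {m x y z} → x ≡ y mod m → y ≡ z mod m → x ≡ z mod m
  ≡-trans {m} {x} {y} {z} (d , e , x≈y) (d′ , e′ , y≈z) = d + d′ , e′ + e , (begin
    x + m * (d + d′)     ≈⟨ regroup x d d′ ⟩
    (x + m * d) + m * d′ ≈⟨ +-congʳ x≈y ⟩
    (y + m * e) + m * d′ ≈⟨ swap y e d′ ⟩
    (y + m * d′) + m * e ≈⟨ +-congʳ y≈z ⟩
    (z + m * e′) + m * e ≈⟨ regroup z e′ e ⟨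
    z + m * (e′ + e)     ∎)
    where
    open ≈-Reasoning
    regroup : ∀ x d d′ → x + m * (d + d′) ≈ (x + m * d) + m * d′
    regroup = solve 4 (λ m x d d′ → x :+ m :* (d :+ d′) := (x :+ m :* d) :+ m :* d′) refl m
    swap : ∀ y e d′ → (y + m * e) + m * d′ ≈ (y + m * d′) + m * e
    swap = solve 4 (λ m y e d′ → (y :+ m :* e) :+ m :* d′ := (y :+ m :* d′) :+ m :* e) refl m

  ≡-setoid : Carrier → Setoid c (c ⊔ ℓ)
  ≡-setoid m = record
    { Carrier       = Carrier
    ; _≈_           = λ x y → x ≡ y mod m
    ; isEquivalence = record { refl = ≡-refl ; sym = ≡-sym ; trans = ≡-trans }
    }

  module ≡-mod-Reasoning m = Relation.Binary.Reasoning.Setoid (≡-setoid m)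

  ≡-+-cong : ∀ {m x y u v} → x ≡ y mod m → u ≡ v mod m → x + u ≡ y + v mod m
  ≡-+-cong {m} {x} {y} {u} {v} (d , e , x≈y) (d′ , e′ , u≈v) = d + d′ , e + e′ , (begin
    (x + u) + m * (d + d′)     ≈⟨ interchange x u d d′ ⟩
    (x + m * d) + (u + m * d′) ≈⟨ +-cong x≈y u≈v ⟩
    (y + m * e) + (v + m * e′) ≈⟨ interchange y v e e′ ⟨
    (y + v) + m * (e + e′)     ∎)
    where
    open ≈-Reasoning
    interchange : ∀ x u d d′ → (x + u) + m * (d + d′) ≈ (x + m * d) + (u + m * d′)
    interchange = solve 5 (λ m x u d d′ → (x :+ u) :+ m :* (d :+ d′) := (x :+ m :* d) :+ (u :+ m :* d′)) refl m

  ≡-*-cong : ∀ {m x y u v} → x ≡ y mod m → u ≡ v mod m → x * u ≡ y * v mod m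
  ≡-*-cong {m} {x} {y} {u} {v} (d , e , x≈y) (d′ , e′ , u≈v) =
    d * u + x * d′ + m * (d * d′) , e * v + y * e′ + m * (e * e′) , (begin
    x * u + m * (d * u + x * d′ + m * (d * d′)) ≈⟨ expand x u d d′ ⟩
    (x + m * d) * (u + m * d′)                  ≈⟨ *-cong x≈y u≈v ⟩
    (y + m * e) * (v + m * e′)                  ≈⟨ expand y v e e′ ⟨
    y * v + m * (e * v + y * e′ + m * (e * e′)) ∎)
    where
    open ≈-Reasoning
    expand : ∀ x u d d′ → x * u + m * (d * u + x * d′ + m * (d * d′)) ≈ (x + m * d) * (u + m * d′)
    expand = solve 5 (λ m x u d d′ → x :* u :+ m :* (d :* u :+ x :* d′ :+ m :* (d :* d′))
                                      := (x :+ m :* d) :* (u :+ m :* d′)) refl m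

  ≡-^-cong : ∀ {m x y} n → x ≡ y mod m → x ^ n ≡ y ^ n mod m
  ≡-^-cong zero    x≡y = ≡-refl
  ≡-^-cong (suc n) x≡y = ≡-*-cong x≡y (≡-^-cong n x≡y)

  ≡-resp-modulus : ∀ {m m′ x y} → m ≈ m′ → x ≡ y mod m → x ≡ y mod m′
  ≡-resp-modulus m≈m′ (d , e , x≈y) =
    d , e , trans (+-congˡ (*-congʳ (sym m≈m′))) (trans x≈y (+-congˡ (*-congʳ m≈m′)))

  mod-*⇒mod : ∀ {m n x y} → x ≡ y mod m * n → x ≡ y mod m
  mod-*⇒mod {m} {n} (d , e , x≈y) =
    n * d , n * e , trans (+-congˡ (sym (*-assoc m n d))) (trans x≈y (+-congˡ (*-assoc m n e)))

  m*x≡0 : ∀ m x → m * x ≡ 0# mod m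
  m*x≡0 m x = 0# , x , trans (+-congˡ (zeroʳ m)) (trans (+-identityʳ (m * x)) (sym (+-identityˡ (m * x))))

  n×x≡0 : ∀ {m} n s → n × (m * s) ≡ 0# mod m
  n×x≡0 {m} n s = ≡-trans (≡-reflexive (sym (×-comm-* n m s))) (m*x≡0 m (n × s))

  ×≈×1#* : ∀ n x → n × x ≈ (n × 1#) * x
  ×≈×1#* n x = trans (×-congʳ n (sym (*-identityˡ x))) (sym (×-assoc-* n 1# x))

  ∣⇒×≡0 : ∀ {k n} x → k ∣ n → n × x ≡ 0# mod k × 1#
  ∣⇒×≡0 {k} x (divides q ≡.refl) = ≡-trans (≡-reflexive (begin
    (q ℕ.* k) × x             ≈⟨ ×≈×1#* (q ℕ.* k) x ⟩
    ((q ℕ.* k) × 1#) * x      ≈⟨ *-congʳ (×1-homo-* q k) ⟩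
    ((q × 1#) * (k × 1#)) * x ≈⟨ *-congʳ (*-comm (q × 1#) (k × 1#)) ⟩
    ((k × 1#) * (q × 1#)) * x ≈⟨ *-assoc (k × 1#) (q × 1#) x ⟩
    (k × 1#) * ((q × 1#) * x) ∎)) (m*x≡0 (k × 1#) ((q × 1#) * x))
    where open ≈-Reasoning

  sum-≡0 : ∀ {m n} (f : Fin n → Carrier) → (∀ i → f i ≡ 0# mod m) → sum f ≡ 0# mod m
  sum-≡0 {n = zero}  f f≡0 = ≡-refl
  sum-≡0 {n = suc n} f f≡0 =
    ≡-trans (≡-+-cong (f≡0 zero) (sum-≡0 (f ∘ suc) (f≡0 ∘ suc))) (≡-reflexive (+-identityˡ 0#))

  1#^n≈1# : ∀ n → 1# ^ n ≈ 1#
  1#^n≈1# zero    = refl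
  1#^n≈1# (suc n) = trans (*-identityˡ (1# ^ n)) (1#^n≈1# n)

  binomialTerm-first : ∀ x y n → binomialTerm x y n zero ≈ y ^ n
  binomialTerm-first x y n = trans (+-identityʳ (1# * y ^ n)) (*-identityˡ (y ^ n))

  binomialTerm-last : ∀ x y n → binomialTerm x y n (fromℕ n) ≈ x ^ n
  binomialTerm-last x y n rewrite toℕ-fromℕ n | nCn≡1 n | ℕ.n∸n≡0 n =
    trans (+-identityʳ (x ^ n * 1#)) (*-identityʳ (x ^ n))

  frobenius : ∀ {p} → Prime p → ∀ x y → (x + y) ^ p ≡ x ^ p + y ^ p mod p × 1#
  frobenius {p@(suc q)} pp x y = begin
    (x + y) ^ p                               ≈⟨ ≡-reflexive (theorem p x y) ⟩
    sum term                                  ≈⟨ ≡-reflexive (+-congˡ (sum-init-last (term ∘ suc))) ⟩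
    term zero + (sum middle + term (fromℕ p)) ≈⟨ ≡-+-cong (≡-reflexive (binomialTerm-first x y p))
                                                   (≡-+-cong (sum-≡0 middle middle≡0) (≡-reflexive (binomialTerm-last x y p))) ⟩
    y ^ p + (0# + x ^ p)                      ≈⟨ ≡-reflexive (trans (+-congˡ (+-identityˡ (x ^ p))) (+-comm (y ^ p) (x ^ p))) ⟩
    x ^ p + y ^ p                             ∎
    where
    open ≡-mod-Reasoning (p × 1#)
    term = binomialTerm x y p
    middle : Fin q → Carrier
    middle i = term (suc (inject₁ i))
    middle≡0 : ∀ i → middle i ≡ 0# mod p × 1#
    middle≡0 i = ∣⇒×≡0 _ (prime∣pC[1+k] pp (s<s (≡.subst (_< q) (≡.sym (toℕ-inject₁ i)) (toℕ<n i))))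

  fermat : ∀ {p} → Prime p → ∀ a → (a × 1#) ^ p ≡ a × 1# mod p × 1#
  fermat {suc q} pp zero    = ≡-reflexive (zeroˡ (0# ^ q))
  fermat {p}     pp (suc a) = begin
    (1# + a × 1#) ^ p     ≈⟨ frobenius pp 1# (a × 1#) ⟩
    1# ^ p + (a × 1#) ^ p ≈⟨ ≡-+-cong (≡-reflexive (1#^n≈1# p)) (fermat pp a) ⟩
    1# + a × 1#           ∎
    where open ≡-mod-Reasoning (p × 1#)

  frobenius-affine : ∀ {p} → Prime p → ∀ a b x →
                     (a × 1# + (b × 1#) * x) ^ p ≡ a × 1# + (b × 1#) * x ^ p mod p × 1#
  frobenius-affine {p} pp a b x = begin
    (a × 1# + (b × 1#) * x) ^ p       ≈⟨ frobenius pp (a × 1#) ((b × 1#) * x) ⟩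
    (a × 1#) ^ p + ((b × 1#) * x) ^ p ≈⟨ ≡-+-cong (fermat pp a) (≡-reflexive (^-distrib-* (b × 1#) x p)) ⟩
    a × 1# + (b × 1#) ^ p * x ^ p     ≈⟨ ≡-+-cong ≡-refl (≡-*-cong (fermat pp b) ≡-refl) ⟩
    a × 1# + (b × 1#) * x ^ p         ∎
    where open ≡-mod-Reasoning (p × 1#)

  -- With q = p × 1# and t = q m d, the linear term of (t + z)^p carries the coefficient p and the
  -- higher ones carry t² = q (q m) m d², so all of them vanish modulo q (q m).
  binomialTerm-lift≡0 : ∀ {p} m d z (k : Fin p) →
    binomialTerm ((p × 1#) * m * d) z p (suc k) ≡ 0# mod (p × 1#) * ((p × 1#) * m)
  binomialTerm-lift≡0 {p@(suc _)} m d z zero rewrite nC1≡n p = ≡-trans (≡-reflexive (begin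
    p × ((q * m * d * 1#) * r)  ≈⟨ ×≈×1#* p ((q * m * d * 1#) * r) ⟩
    q * ((q * m * d * 1#) * r)  ≈⟨ reassociate q m d r ⟩
    q * (q * m) * (d * r)       ∎)) (m*x≡0 (q * (q * m)) (d * r))
    where
    open ≈-Reasoning
    q = p × 1#
    r = z ^ (p ℕ.∸ 1)
    reassociate : ∀ q m d r → q * ((q * m * d * 1#) * r) ≈ q * (q * m) * (d * r)
    reassociate = solve 4 (λ q m d r → q :* ((q :* m :* d :* con 1) :* r) := q :* (q :* m) :* (d :* r)) refl
  binomialTerm-lift≡0 {p@(suc _)} m d z (suc k) =
    ≡-trans (≡-reflexive (×-congʳ (p C (2 ℕ.+ toℕ k)) (reassociate q m d s r)))
            (n×x≡0 (p C (2 ℕ.+ toℕ k)) (m * d * d * s * r))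
    where
    q = p × 1#
    s = (q * m * d) ^ toℕ k
    r = z ^ (p ℕ.∸ (2 ℕ.+ toℕ k))
    reassociate : ∀ q m d s r → (q * m * d) * ((q * m * d) * s) * r ≈ q * (q * m) * (m * d * d * s * r)
    reassociate = solve 5 (λ q m d s r → (q :* m :* d) :* ((q :* m :* d) :* s) :* r
                                         := q :* (q :* m) :* (m :* d :* d :* s :* r)) refl

  ^-lift : ∀ p {m x y} → x ≡ y mod (p × 1#) * m → x ^ p ≡ y ^ p mod (p × 1#) * ((p × 1#) * m)
  ^-lift p {m} {x} {y} (d , e , x≈y) = begin
    x ^ p             ≈⟨ absorb x d ⟨
    (x + qm * d) ^ p  ≈⟨ ≡-reflexive (^-congˡ p x≈y) ⟩
    (y + qm * e) ^ p  ≈⟨ absorb y e ⟩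
    y ^ p             ∎
    where
    open ≡-mod-Reasoning ((p × 1#) * ((p × 1#) * m))
    qm = (p × 1#) * m
    absorb : ∀ z d → (z + qm * d) ^ p ≡ z ^ p mod (p × 1#) * qm
    absorb z d = begin
      (z + qm * d) ^ p                ≈⟨ ≡-reflexive (^-congˡ p (+-comm z (qm * d))) ⟩
      (qm * d + z) ^ p                ≈⟨ ≡-reflexive (theorem p (qm * d) z) ⟩
      sum (binomialTerm (qm * d) z p) ≈⟨ ≡-+-cong (≡-reflexive (binomialTerm-first (qm * d) z p))
                                                   (sum-≡0 _ (binomialTerm-lift≡0 {p} m d z)) ⟩
      z ^ p + 0#                      ≈⟨ ≡-reflexive (+-identityʳ (z ^ p)) ⟩
      z ^ p                           ∎

  ^-p^i-lift : ∀ p i {x y} → x ≡ y mod p × 1# → x ^ (p ℕ.^ i) ≡ y ^ (p ℕ.^ i) mod (p × 1#) ^ suc i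
  ^-p^i-lift p zero    x≡y = ≡-resp-modulus (sym (*-identityʳ (p × 1#))) (≡-^-cong 1 x≡y)
  ^-p^i-lift p (suc i) {x} {y} x≡y = begin
    x ^ (p ℕ.* p ℕ.^ i)  ≈⟨ ≡-reflexive (^-p^[1+i] x) ⟩
    (x ^ (p ℕ.^ i)) ^ p  ≈⟨ ^-lift p (^-p^i-lift p i x≡y) ⟩
    (y ^ (p ℕ.^ i)) ^ p  ≈⟨ ≡-reflexive (^-p^[1+i] y) ⟨
    y ^ (p ℕ.* p ℕ.^ i)  ∎
    where
    open ≡-mod-Reasoning ((p × 1#) ^ suc (suc i))
    ^-p^[1+i] : ∀ z → z ^ (p ℕ.* p ℕ.^ i) ≈ (z ^ (p ℕ.^ i)) ^ p
    ^-p^[1+i] z = sym (trans (^-assocʳ z (p ℕ.^ i) p) (reflexive (≡.cong (z ^_) (ℕ.*-comm (p ℕ.^ i) p))))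

module IntegerResidues where
  open import Data.Integer.Base using (+_; _+_; _-_; _*_; 1ℤ)
  import Data.Integer.Base as ℤ
  open import Data.Integer.Properties using (abs-*)
  open import Data.Integer.Divisibility.Signed
  open import Data.Integer.Tactic.RingSolver using (solve)
  open import Data.Product.Base using (_×_)

  euclidsLemma-ℤ : ∀ {p} x y → Prime p → + p ∣ x * y → + p ∣ x ⊎ + p ∣ y
  euclidsLemma-ℤ {p} x y pp p∣xy
    with euclidsLemma ℤ.∣ x ∣ ℤ.∣ y ∣ pp (≡.subst (p ℕ.∣_) (abs-* x y) (∣⇒∣ᵤ p∣xy))
  ... | inj₁ p∣x = inj₁ (∣ᵤ⇒∣ p∣x)
  ... | inj₂ p∣y = inj₂ (∣ᵤ⇒∣ p∣y)

  +-≡⇒∣- : ∀ {k a a′ d e} → a + k * d ≡ a′ + k * e → k ∣ a - a′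
  +-≡⇒∣- {k} {a} {a′} {d} {e} eq = divides (e - d) (begin
    a - a′                                      ≡⟨ solve (k ∷ a ∷ a′ ∷ d ∷ e ∷ []) ⟩
    (a + k * d) - (a′ + k * e) + (e - d) * k    ≡⟨ ≡.cong (λ t → t - (a′ + k * e) + (e - d) * k) eq ⟩
    (a′ + k * e) - (a′ + k * e) + (e - d) * k   ≡⟨ solve (k ∷ a′ ∷ d ∷ e ∷ []) ⟩
    (e - d) * k                                 ∎)
    where open ≡.≡-Reasoning

  -- The hypotheses say that a + b φ is a root of T² − T − 1 modulo p, the conclusions that the map
  -- w ↦ a + b w, applied twice to a + b φ, returns it.  Modulo 5 that polynomial has a double root,
  -- where the conclusions need p ∣ b.
  golden-root-residues : ∀ {p} a b → Prime p → (+ p ∣ + 5 → + p ∣ b) →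
    + p ∣ a * a + b * b - (a + 1ℤ) → + p ∣ b * (a + a + b - 1ℤ) →
    + p ∣ a * b * (1ℤ + b) × + p ∣ b * (b * b - 1ℤ)
  golden-root-residues {p} a b pp p∣5⇒p∣b p∣N p∣bT =
    [ from-b , from-T ] (euclidsLemma-ℤ b (a + a + b - 1ℤ) pp p∣bT)
    where
    discriminant : + 4 * (a * a + b * b - (a + 1ℤ)) - (a + a + b - 1ℤ) * (a + a - b - 1ℤ) ≡ + 5 * (b * b - 1ℤ)
    discriminant = solve (a ∷ b ∷ [])

    from-b : + p ∣ b → + p ∣ a * b * (1ℤ + b) × + p ∣ b * (b * b - 1ℤ)
    from-b p∣b = ∣m⇒∣m*n (1ℤ + b) (∣n⇒∣m*n a p∣b) , ∣m⇒∣m*n (b * b - 1ℤ) p∣b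

    from-b²-1 : + p ∣ a + a + b - 1ℤ → + p ∣ b * b - 1ℤ → + p ∣ a * b * (1ℤ + b) × + p ∣ b * (b * b - 1ℤ)
    from-b²-1 p∣T p∣b²-1 =
      [ from-2 , from-a[1+b] ] (euclidsLemma-ℤ (+ 2) (a * (1ℤ + b)) pp p∣2a[1+b]) , ∣n⇒∣m*n b p∣b²-1
      where
      2a[1+b] : (1ℤ + b) * (a + a + b - 1ℤ) - (b * b - 1ℤ) ≡ + 2 * (a * (1ℤ + b))
      2a[1+b] = solve (a ∷ b ∷ [])
      p∣2a[1+b] : + p ∣ + 2 * (a * (1ℤ + b))
      p∣2a[1+b] = ∣-trans (∣m∣n⇒∣m-n (∣n⇒∣m*n (1ℤ + b) p∣T) p∣b²-1) (∣-reflexive 2a[1+b])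

      from-a[1+b] : + p ∣ a * (1ℤ + b) → + p ∣ a * b * (1ℤ + b)
      from-a[1+b] p∣a[1+b] = ∣-trans (∣n⇒∣m*n b p∣a[1+b]) (∣-reflexive reorder)
        where
        reorder : b * (a * (1ℤ + b)) ≡ a * b * (1ℤ + b)
        reorder = solve (a ∷ b ∷ [])

      -- p = 2 divides one of b − 1 and b + 1, hence both.
      from-2 : + p ∣ + 2 → + p ∣ a * b * (1ℤ + b)
      from-2 p∣2 = ∣n⇒∣m*n (a * b) ([ (λ p∣b-1 → ∣-trans (∣m∣n⇒∣m+n p∣b-1 p∣2) (∣-reflexive b-1+2)) , id ]
                                      (euclidsLemma-ℤ (b - 1ℤ) (1ℤ + b) pp (∣-trans p∣b²-1 (∣-reflexive b²-1))))
        where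
        b-1+2 : b - 1ℤ + + 2 ≡ 1ℤ + b
        b-1+2 = solve (b ∷ [])
        b²-1 : b * b - 1ℤ ≡ (b - 1ℤ) * (1ℤ + b)
        b²-1 = solve (b ∷ [])

    from-T : + p ∣ a + a + b - 1ℤ → + p ∣ a * b * (1ℤ + b) × + p ∣ b * (b * b - 1ℤ)
    from-T p∣T = [ from-b ∘ p∣5⇒p∣b , from-b²-1 p∣T ] (euclidsLemma-ℤ (+ 5) (b * b - 1ℤ) pp p∣5[b²-1])
      where
      p∣5[b²-1] : + p ∣ + 5 * (b * b - 1ℤ)
      p∣5[b²-1] = ∣-trans (∣m∣n⇒∣m-n (∣n⇒∣m*n (+ 4) p∣N) (∣m⇒∣m*n (a + a - b - 1ℤ) p∣T))
                          (∣-reflexive discriminant)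

open IntegerResidues using (+-≡⇒∣-; golden-root-residues)

module GoldenIntegers where
  open import Data.Integer.Base using (ℤ; 0ℤ; 1ℤ; _+_; _*_)
  open import Data.Integer.Tactic.RingSolver using (solve)

  -- ⟪ a , b ⟫ stands for a + b φ, where φ² = φ + 1.
  data ℤ[φ] : Set where
    ⟪_,_⟫ : ℤ → ℤ → ℤ[φ]

  c₀ c₁ : ℤ[φ] → ℤ
  c₀ ⟪ a , _ ⟫ = a
  c₁ ⟪ _ , b ⟫ = b

  infixl 6 _⊕_
  infixl 7 _⊗_

  _⊕_ : ℤ[φ] → ℤ[φ] → ℤ[φ]
  ⟪ a , b ⟫ ⊕ ⟪ c , d ⟫ = ⟪ a + c , b + d ⟫

  _⊗_ : ℤ[φ] → ℤ[φ] → ℤ[φ]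
  ⟪ a , b ⟫ ⊗ ⟪ c , d ⟫ = ⟪ a * c + b * d , a * d + b * c + b * d ⟫

  φ : ℤ[φ]
  φ = ⟪ 0ℤ , 1ℤ ⟫

  open import Algebra.Structures (≡._≡_ {A = ℤ[φ]}) using (IsSemigroup)
  open import Algebra.Structures.Biased (≡._≡_ {A = ℤ[φ]}) using (isCommutativeMonoidˡ; isCommutativeSemiringˡ)

  ℤ[φ]-commutativeSemiring : CommutativeSemiring 0ℓ 0ℓ
  ℤ[φ]-commutativeSemiring = record
    { Carrier = ℤ[φ]
    ; _≈_ = ≡._≡_
    ; _+_ = _⊕_
    ; _*_ = _⊗_
    ; 0# = ⟪ 0ℤ , 0ℤ ⟫
    ; 1# = ⟪ 1ℤ , 0ℤ ⟫
    ; isCommutativeSemiring = isCommutativeSemiringˡ record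
      { +-isCommutativeMonoid = isCommutativeMonoidˡ record
        { isSemigroup = isSemigroup _⊕_ λ where
            ⟪ a , b ⟫ ⟪ c , d ⟫ ⟪ e , f ⟫ → ≡.cong₂ ⟪_,_⟫ (solve (a ∷ c ∷ e ∷ [])) (solve (b ∷ d ∷ f ∷ []))
        ; identityˡ = λ where
            ⟪ a , b ⟫ → ≡.cong₂ ⟪_,_⟫ (solve (a ∷ [])) (solve (b ∷ []))
        ; comm = λ where
            ⟪ a , b ⟫ ⟪ c , d ⟫ → ≡.cong₂ ⟪_,_⟫ (solve (a ∷ c ∷ [])) (solve (b ∷ d ∷ []))
        }
      ; *-isCommutativeMonoid = isCommutativeMonoidˡ record
        { isSemigroup = isSemigroup _⊗_ λ where
            ⟪ a , b ⟫ ⟪ c , d ⟫ ⟪ e , f ⟫ → ≡.cong₂ ⟪_,_⟫ (solve (a ∷ b ∷ c ∷ d ∷ e ∷ f ∷ []))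
                                                          (solve (a ∷ b ∷ c ∷ d ∷ e ∷ f ∷ []))
        ; identityˡ = λ where
            ⟪ a , b ⟫ → ≡.cong₂ ⟪_,_⟫ (solve (a ∷ b ∷ [])) (solve (a ∷ b ∷ []))
        ; comm = λ where
            ⟪ a , b ⟫ ⟪ c , d ⟫ → ≡.cong₂ ⟪_,_⟫ (solve (a ∷ b ∷ c ∷ d ∷ [])) (solve (a ∷ b ∷ c ∷ d ∷ []))
        }
      ; distribʳ = λ where
          ⟪ a , b ⟫ ⟪ c , d ⟫ ⟪ e , f ⟫ → ≡.cong₂ ⟪_,_⟫ (solve (a ∷ b ∷ c ∷ d ∷ e ∷ f ∷ []))
                                                        (solve (a ∷ b ∷ c ∷ d ∷ e ∷ f ∷ []))
      ; zeroˡ = λ where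
          ⟪ a , b ⟫ → ≡.cong₂ ⟪_,_⟫ (solve (a ∷ b ∷ [])) (solve (a ∷ b ∷ []))
      }
    }
    where
    isSemigroup : ∀ _∙_ → (∀ x y z → (x ∙ y) ∙ z ≡.≡ x ∙ (y ∙ z)) → IsSemigroup _∙_
    isSemigroup _∙_ assoc = record
      { isMagma = record { isEquivalence = ≡.isEquivalence ; ∙-cong = ≡.cong₂ _∙_ }
      ; assoc = assoc
      }

open GoldenIntegers using (⟪_,_⟫; c₀; c₁; φ; ℤ[φ]-commutativeSemiring)

module FibonacciCongruences where
  open CommutativeSemiring ℤ[φ]-commutativeSemiring hiding (zero)
  open import Algebra.Properties.Semiring.Mult semiring using (_×_)
  open import Algebra.Properties.Semiring.Exp semiring using (_^_; ^-congˡ; ^-congʳ; ^-assocʳ; ^-homo-*)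
  open import Algebra.Properties.CommutativeSemiring.Exp ℤ[φ]-commutativeSemiring using (^-distrib-*)
  open CongruenceModulo ℤ[φ]-commutativeSemiring
  open import Data.Integer.Base as ℤ using (+_; 0ℤ; 1ℤ)
  import Data.Integer.Properties as ℤ
  open import Data.Integer.Divisibility.Signed using (_∣_; divides; ∣ᵤ⇒∣; ∣⇒∣ᵤ; ∣-trans; ∣-reflexive)
  open import Data.Integer.Tactic.RingSolver using (solve)
  open import Data.Nat.Primality using (prime?; prime⇒irreducible; ¬prime[1])
  open import Data.Nat.Tactic.RingSolver using () renaming (solve-∀ to solve-∀ℕ)
  open import Data.Product.Base using () renaming (_×_ to _×ₚ_)
  open import Relation.Nullary.Decidable using (from-yes)

  n×1#≡⟪n,0⟫ : ∀ n → n × 1# ≡ ⟪ + n , 0ℤ ⟫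
  n×1#≡⟪n,0⟫ zero    = ≡.refl
  n×1#≡⟪n,0⟫ (suc n) = ≡.cong (_+_ 1#) (n×1#≡⟪n,0⟫ n)

  ⟪k,0⟫*⟪d₀,d₁⟫≡⟪kd₀,kd₁⟫ : ∀ k d₀ d₁ → ⟪ k , 0ℤ ⟫ * ⟪ d₀ , d₁ ⟫ ≡ ⟪ k ℤ.* d₀ , k ℤ.* d₁ ⟫
  ⟪k,0⟫*⟪d₀,d₁⟫≡⟪kd₀,kd₁⟫ k d₀ d₁ = ≡.cong₂ ⟪_,_⟫ (solve (k ∷ d₀ ∷ d₁ ∷ [])) (solve (k ∷ d₀ ∷ d₁ ∷ []))

  ⟪n,0⟫^k≡⟪n^k,0⟫ : ∀ n k → ⟪ + n , 0ℤ ⟫ ^ k ≡ ⟪ + (n ℕ.^ k) , 0ℤ ⟫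
  ⟪n,0⟫^k≡⟪n^k,0⟫ n zero    = ≡.refl
  ⟪n,0⟫^k≡⟪n^k,0⟫ n (suc k) = begin
    ⟪ + n , 0ℤ ⟫ * ⟪ + n , 0ℤ ⟫ ^ k                ≡⟨ ≡.cong (⟪ + n , 0ℤ ⟫ *_) (⟪n,0⟫^k≡⟪n^k,0⟫ n k) ⟩
    ⟪ + n , 0ℤ ⟫ * ⟪ + (n ℕ.^ k) , 0ℤ ⟫            ≡⟨ ⟪k,0⟫*⟪d₀,d₁⟫≡⟪kd₀,kd₁⟫ (+ n) (+ (n ℕ.^ k)) 0ℤ ⟩
    ⟪ + n ℤ.* + (n ℕ.^ k) , + n ℤ.* 0ℤ ⟫          ≡⟨ ≡.cong₂ ⟪_,_⟫ (ℤ.pos-* n (n ℕ.^ k)) (≡.sym (ℤ.*-zeroʳ (+ n))) ⟨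
    ⟪ + (n ℕ.^ suc k) , 0ℤ ⟫                      ∎
    where open ≡.≡-Reasoning

  p×1#^k≡⟪p^k,0⟫ : ∀ p k → (p × 1#) ^ k ≡ ⟪ + (p ℕ.^ k) , 0ℤ ⟫
  p×1#^k≡⟪p^k,0⟫ p k = ≡.trans (≡.cong (_^ k) (n×1#≡⟪n,0⟫ p)) (⟪n,0⟫^k≡⟪n^k,0⟫ p k)

  ⟪a,0⟫+⟪b,0⟫*φ≡⟪a,b⟫ : ∀ a b → ⟪ a , 0ℤ ⟫ + ⟪ b , 0ℤ ⟫ * φ ≡ ⟪ a , b ⟫
  ⟪a,0⟫+⟪b,0⟫*φ≡⟪a,b⟫ a b = ≡.cong₂ ⟪_,_⟫ (solve (a ∷ b ∷ [])) (solve (a ∷ b ∷ []))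

  φ*⟪a,b⟫≡⟪b,b+a⟫ : ∀ a b → φ * ⟪ a , b ⟫ ≡ ⟪ b , b ℤ.+ a ⟫
  φ*⟪a,b⟫≡⟪b,b+a⟫ a b = ≡.cong₂ ⟪_,_⟫ (solve (a ∷ b ∷ [])) (solve (a ∷ b ∷ []))

  φ^[1+n]≡⟪Fn,F[1+n]⟫ : ∀ n → φ ^ suc n ≡ ⟪ + F n , + F (suc n) ⟫
  φ^[1+n]≡⟪Fn,F[1+n]⟫ zero    = ≡.refl
  φ^[1+n]≡⟪Fn,F[1+n]⟫ (suc n) = begin
    φ * φ ^ suc n                            ≡⟨ ≡.cong (φ *_) (φ^[1+n]≡⟪Fn,F[1+n]⟫ n) ⟩
    φ * ⟪ + F n , + F (suc n) ⟫              ≡⟨ φ*⟪a,b⟫≡⟪b,b+a⟫ (+ F n) (+ F (suc n)) ⟩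
    ⟪ + F (suc n) , + F (suc n) ℤ.+ + F n ⟫  ≡⟨ ≡.cong ⟪ + F (suc n) ,_⟫ (ℤ.pos-+ (F (suc n)) (F n)) ⟨
    ⟪ + F (suc n) , + F (suc (suc n)) ⟫      ∎
    where open ≡.≡-Reasoning

  ≡mod⟪k,0⟫⇒∣ : ∀ {k x y} → x ≡ y mod ⟪ k , 0ℤ ⟫ → k ∣ c₀ x ℤ.- c₀ y ×ₚ k ∣ c₁ x ℤ.- c₁ y
  ≡mod⟪k,0⟫⇒∣ {k} {x@(⟪ a , b ⟫)} {y@(⟪ a′ , b′ ⟫)} (⟪ d₀ , d₁ ⟫ , ⟪ e₀ , e₁ ⟫ , eq) =
    +-≡⇒∣- {k} {a} {a′} {d₀} {e₀} (≡.cong c₀ eq′) , +-≡⇒∣- {k} {b} {b′} {d₁} {e₁} (≡.cong c₁ eq′)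
    where
    eq′ : x + ⟪ k ℤ.* d₀ , k ℤ.* d₁ ⟫ ≡ y + ⟪ k ℤ.* e₀ , k ℤ.* e₁ ⟫
    eq′ = ≡.trans (≡.cong (_+_ x) (≡.sym (⟪k,0⟫*⟪d₀,d₁⟫≡⟪kd₀,kd₁⟫ k d₀ d₁)))
            (≡.trans eq (≡.cong (_+_ y) (⟪k,0⟫*⟪d₀,d₁⟫≡⟪kd₀,kd₁⟫ k e₀ e₁)))

  ∣⇒⟪u,v⟫≡0 : ∀ {k u v} → k ∣ u → k ∣ v → ⟪ u , v ⟫ ≡ 0# mod ⟪ k , 0ℤ ⟫
  ∣⇒⟪u,v⟫≡0 {k} (divides q₀ ≡.refl) (divides q₁ ≡.refl) = ≡-trans
    (≡-reflexive (≡.trans (≡.cong₂ ⟪_,_⟫ (ℤ.*-comm q₀ k) (ℤ.*-comm q₁ k))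
                          (≡.sym (⟪k,0⟫*⟪d₀,d₁⟫≡⟪kd₀,kd₁⟫ k q₀ q₁))))
    (m*x≡0 ⟪ k , 0ℤ ⟫ ⟪ q₀ , q₁ ⟫)

  prime∣5⇒∣F : ∀ {p} → Prime p → p ℕ.∣ 5 → p ℕ.∣ F p
  prime∣5⇒∣F pp p∣5 with prime⇒irreducible (from-yes (prime? 5)) p∣5
  ... | inj₁ ≡.refl = ⊥-elim (¬prime[1] pp)
  ... | inj₂ ≡.refl = ℕ.∣-refl

  φ^p*φ^p≡φ^p+1 : ∀ {p} → Prime p → φ ^ p * φ ^ p ≡ φ ^ p + 1# mod p × 1#
  φ^p*φ^p≡φ^p+1 {p} pp = begin
    φ ^ p * φ ^ p   ≈⟨ ≡-reflexive (sym (^-distrib-* φ φ p)) ⟩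
    (φ * φ) ^ p     ≡⟨⟩
    (φ + 1#) ^ p    ≈⟨ frobenius pp φ 1# ⟩
    φ ^ p + 1# ^ p  ≈⟨ ≡-reflexive (+-congˡ (1#^n≈1# p)) ⟩
    φ ^ p + 1#      ∎
    where open ≡-mod-Reasoning (p × 1#)

  affine²-fixes-root : ∀ {p} a b → Prime p → (p ℕ.∣ 5 → p ℕ.∣ b) →
    ⟪ + a , + b ⟫ * ⟪ + a , + b ⟫ ≡ ⟪ + a , + b ⟫ + 1# mod p × 1# →
    a × 1# + (b × 1#) * (a × 1# + (b × 1#) * ⟪ + a , + b ⟫) ≡ ⟪ + a , + b ⟫ mod p × 1#
  affine²-fixes-root {p} a b pp p∣5⇒p∣b root rewrite n×1#≡⟪n,0⟫ p | n×1#≡⟪n,0⟫ a | n×1#≡⟪n,0⟫ b = begin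
    ⟪ + a , 0ℤ ⟫ + ⟪ + b , 0ℤ ⟫ * (⟪ + a , 0ℤ ⟫ + ⟪ + b , 0ℤ ⟫ * y)   ≈⟨ ≡-reflexive (expand (+ a) (+ b)) ⟩
    y + ⟪ + a ℤ.* + b ℤ.* (1ℤ ℤ.+ + b) , + b ℤ.* (+ b ℤ.* + b ℤ.- 1ℤ) ⟫ ≈⟨ ≡-+-cong {x = y} {y = y} ≡-refl
                                                                              (∣⇒⟪u,v⟫≡0 (proj₁ residues) (proj₂ residues)) ⟩
    y + 0#                                                               ≈⟨ ≡-reflexive (+-identityʳ y) ⟩
    y                                                                    ∎
    where
    open ≡-mod-Reasoning ⟪ + p , 0ℤ ⟫
    y = ⟪ + a , + b ⟫
    expand : ∀ a b → ⟪ a , 0ℤ ⟫ + ⟪ b , 0ℤ ⟫ * (⟪ a , 0ℤ ⟫ + ⟪ b , 0ℤ ⟫ * ⟪ a , b ⟫)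
                     ≡ ⟪ a , b ⟫ + ⟪ a ℤ.* b ℤ.* (1ℤ ℤ.+ b) , b ℤ.* (b ℤ.* b ℤ.- 1ℤ) ⟫
    expand a b = ≡.cong₂ ⟪_,_⟫ (solve (a ∷ b ∷ [])) (solve (a ∷ b ∷ []))
    c₁[y*y-y-1] : ∀ a b → a ℤ.* b ℤ.+ b ℤ.* a ℤ.+ b ℤ.* b ℤ.- (b ℤ.+ 0ℤ) ≡ b ℤ.* (a ℤ.+ a ℤ.+ b ℤ.- 1ℤ)
    c₁[y*y-y-1] a b = solve (a ∷ b ∷ [])
    residues = golden-root-residues (+ a) (+ b) pp (∣ᵤ⇒∣ ∘ p∣5⇒p∣b ∘ ∣⇒∣ᵤ) (proj₁ (≡mod⟪k,0⟫⇒∣ root))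
                 (∣-trans (proj₂ (≡mod⟪k,0⟫⇒∣ root)) (∣-reflexive (c₁[y*y-y-1] (+ a) (+ b))))

  φ^[p³]≡φ^p : ∀ {p} → Prime p → φ ^ (p ℕ.^ 3) ≡ φ ^ p mod p × 1#
  φ^[p³]≡φ^p {p@(suc q)} pp = begin
    φ ^ (p ℕ.^ 3)                    ≈⟨ ≡-reflexive φ^[p³]≈y^p^p ⟩
    (y ^ p) ^ p                      ≈⟨ ≡-^-cong p y^p≡A+By ⟩
    (A + B * y) ^ p                  ≈⟨ frobenius-affine pp a b y ⟩
    A + B * y ^ p                    ≈⟨ ≡-+-cong ≡-refl (≡-*-cong ≡-refl y^p≡A+By) ⟩
    A + B * (A + B * y)              ≡⟨ ≡.cong (λ z → A + B * (A + B * z)) y≡⟪a,b⟫ ⟩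
    A + B * (A + B * ⟪ + a , + b ⟫)  ≈⟨ affine²-fixes-root a b pp (prime∣5⇒∣F pp)
                                          (≡.subst (λ z → z * z ≡ z + 1# mod p × 1#) y≡⟪a,b⟫ (φ^p*φ^p≡φ^p+1 pp)) ⟩
    ⟪ + a , + b ⟫                    ≡⟨ y≡⟪a,b⟫ ⟨
    y                                ∎
    where
    open ≡-mod-Reasoning (p × 1#)
    y = φ ^ p
    a = F q
    b = F p
    A = a × 1#
    B = b × 1#
    y≡⟪a,b⟫ : y ≡ ⟪ + a , + b ⟫
    y≡⟪a,b⟫ = φ^[1+n]≡⟪Fn,F[1+n]⟫ q
    y≡A+Bφ : y ≡ A + B * φ
    y≡A+Bφ rewrite n×1#≡⟪n,0⟫ a | n×1#≡⟪n,0⟫ b = ≡.trans y≡⟪a,b⟫ (≡.sym (⟪a,0⟫+⟪b,0⟫*φ≡⟪a,b⟫ (+ a) (+ b)))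
    y^p≡A+By : y ^ p ≡ A + B * y mod p × 1#
    y^p≡A+By = begin
      y ^ p            ≡⟨ ≡.cong (_^ p) y≡A+Bφ ⟩
      (A + B * φ) ^ p  ≈⟨ frobenius-affine pp a b φ ⟩
      A + B * y        ∎
    φ^[p³]≈y^p^p : φ ^ (p ℕ.^ 3) ≈ (y ^ p) ^ p
    φ^[p³]≈y^p^p = sym (trans (^-congˡ p (^-assocʳ φ p p)) (trans (^-assocʳ φ (p ℕ.* p) p) (^-congʳ φ
                     (≡.trans (ℕ.*-assoc p p p) (≡.cong (λ n → p ℕ.* (p ℕ.* n)) (≡.sym (ℕ.*-identityʳ p)))))))

  φ^p^[2k+4]≡φ^p^[2k+2] : ∀ {p} → Prime p → ∀ k →
    φ ^ (p ℕ.^ (2 ℕ.* (2 ℕ.+ k))) ≡ φ ^ (p ℕ.^ (2 ℕ.* (1 ℕ.+ k))) mod (p × 1#) ^ (2 ℕ.+ k)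
  φ^p^[2k+4]≡φ^p^[2k+2] {p} pp k = mod-*⇒mod (≡-resp-modulus q^[2+2k]≈q^[2+k]*q^k (begin
    φ ^ (p ℕ.^ (2 ℕ.* (2 ℕ.+ k)))  ≡⟨ ≡.cong (λ e → φ ^ (p ℕ.^ e)) (3+i≡2[2+k] k) ⟨
    φ ^ (p ℕ.^ (3 ℕ.+ i))          ≈⟨ ≡-reflexive (^-p^-+ 3 i) ⟨
    (φ ^ (p ℕ.^ 3)) ^ (p ℕ.^ i)    ≈⟨ ^-p^i-lift p i (φ^[p³]≡φ^p pp) ⟩
    (φ ^ p) ^ (p ℕ.^ i)            ≡⟨ ≡.cong (λ e → (φ ^ e) ^ (p ℕ.^ i)) (ℕ.*-identityʳ p) ⟨
    (φ ^ (p ℕ.^ 1)) ^ (p ℕ.^ i)    ≈⟨ ≡-reflexive (^-p^-+ 1 i) ⟩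
    φ ^ (p ℕ.^ (1 ℕ.+ i))          ≡⟨ ≡.cong (λ e → φ ^ (p ℕ.^ e)) (1+i≡2[1+k] k) ⟩
    φ ^ (p ℕ.^ (2 ℕ.* (1 ℕ.+ k)))  ∎))
    where
    open ≡-mod-Reasoning ((p × 1#) ^ (2 ℕ.+ (k ℕ.+ k)))
    i = 1 ℕ.+ (k ℕ.+ k)
    ^-p^-+ : ∀ m n → (φ ^ (p ℕ.^ m)) ^ (p ℕ.^ n) ≈ φ ^ (p ℕ.^ (m ℕ.+ n))
    ^-p^-+ m n = trans (^-assocʳ φ (p ℕ.^ m) (p ℕ.^ n)) (^-congʳ φ (≡.sym (ℕ.^-distribˡ-+-* p m n)))
    q^[2+2k]≈q^[2+k]*q^k : (p × 1#) ^ (2 ℕ.+ (k ℕ.+ k)) ≈ (p × 1#) ^ (2 ℕ.+ k) * (p × 1#) ^ k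
    q^[2+2k]≈q^[2+k]*q^k = trans (^-congʳ (p × 1#) (ℕ.+-assoc 2 k k)) (^-homo-* (p × 1#) (2 ℕ.+ k) k)
    3+i≡2[2+k] : ∀ k → 3 ℕ.+ (1 ℕ.+ (k ℕ.+ k)) ≡ 2 ℕ.* (2 ℕ.+ k)
    3+i≡2[2+k] = solve-∀ℕ
    1+i≡2[1+k] : ∀ k → 1 ℕ.+ (1 ℕ.+ (k ℕ.+ k)) ≡ 2 ℕ.* (1 ℕ.+ k)
    1+i≡2[1+k] = solve-∀ℕ

  φ^m≡φ^n⇒F[m+c]≡F[n+c] : ∀ {M m n} → φ ^ m ≡ φ ^ n mod ⟪ + M , 0ℤ ⟫ →
                          ∀ c → + M ∣ + F (m ℕ.+ c) ℤ.- + F (n ℕ.+ c)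
  φ^m≡φ^n⇒F[m+c]≡F[n+c] {M} {m} {n} φᵐ≡φⁿ c = proj₁ (≡mod⟪k,0⟫⇒∣ (begin
    ⟪ + F (m ℕ.+ c) , + F (suc (m ℕ.+ c)) ⟫  ≡⟨ φ^[1+n]≡⟪Fn,F[1+n]⟫ (m ℕ.+ c) ⟨
    φ ^ suc (m ℕ.+ c)                       ≈⟨ ≡-reflexive (split m) ⟩
    φ ^ m * φ ^ suc c                       ≈⟨ ≡-*-cong φᵐ≡φⁿ ≡-refl ⟩
    φ ^ n * φ ^ suc c                       ≈⟨ ≡-reflexive (split n) ⟨
    φ ^ suc (n ℕ.+ c)                       ≡⟨ φ^[1+n]≡⟪Fn,F[1+n]⟫ (n ℕ.+ c) ⟩
    ⟪ + F (n ℕ.+ c) , + F (suc (n ℕ.+ c)) ⟫  ∎))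
    where
    open ≡-mod-Reasoning ⟪ + M , 0ℤ ⟫
    split : ∀ j → φ ^ suc (j ℕ.+ c) ≈ φ ^ j * φ ^ suc c
    split j = trans (^-congʳ φ (≡.sym (ℕ.+-suc j c))) (^-homo-* φ j (suc c))

open FibonacciCongruences using (p×1#^k≡⟪p^k,0⟫; φ^p^[2k+4]≡φ^p^[2k+2]; φ^m≡φ^n⇒F[m+c]≡F[n+c])
open CongruenceModulo ℤ[φ]-commutativeSemiring using (≡-resp-modulus)

open import Data.Nat using (_+_; _*_; _∸_; _^_; _≤_; s≤s; z≤n)
open import Data.Integer using (+_; _-_)
open import Data.Integer.Divisibility using (_∣_)
open import Data.Integer.Divisibility.Signed using (∣⇒∣ᵤ)

lemma2p2 : (p k c : ℕ) → Prime p → 2 ≤ k →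
    (+ (p ^ k)) ∣ ((+ F (p ^ (2 * k) + c)) - (+ F (p ^ (2 * (k ∸ 1)) + c)))
lemma2p2 p (suc (suc k)) c pp (s≤s (s≤s z≤n)) =
  ∣⇒∣ᵤ (φ^m≡φ^n⇒F[m+c]≡F[n+c] {m = p ^ (2 * (2 + k))} {n = p ^ (2 * (1 + k))}
         (≡-resp-modulus (p×1#^k≡⟪p^k,0⟫ p (2 + k)) (φ^p^[2k+4]≡φ^p^[2k+2] pp k)) c)
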